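{- Let $\mathrm{H}$ be the digraph with vertex set $\{0,1,2\}$ and edge set $\{(0,1),(1,1),(1,2),(2,2),(2,0)\}$. Then every polymorphism of $\mathrm{H}$ is essentially unary.
   Context: A $k$-ary polymorphism ($k\ge1$) of $\mathrm{H}$ is a map $f:V(\mathrm{H})^k\to V(\mathrm{H})$ such that whenever $(x_1,y_1),\dots,(x_k,y_k)\in E(\mathrm{H})$, also $(f(x_1,\dots,x_k),f(y_1,\dots,y_k))\in E(\mathrm{H})$. A $k$-ary operation $f$ is essentially unary if there are a unary operation $g$ and $i\in\{1,\dots,k\}$ with $f(x_1,\dots,x_k)=g(x_i)$ for all arguments. -}

module Defs where

open import Data.Nat using (ℕ; suc)
open import Data.Fin using (Fin; zero; suc)
open import Data.Product using (Σ; ∃; _,_)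
open import Relation.Binary.PropositionalEquality using (_≡_)

V : Set
V = Fin 3

v0 v1 v2 : V
v0 = zero
v1 = suc zero
v2 = suc (suc zero)

data E : V → V → Set where
  e01 : E v0 v1
  e11 : E v1 v1
  e12 : E v1 v2
  e22 : E v2 v2
  e20 : E v2 v0

Op : ℕ → Set
Op k = (Fin k → V) → V

IsPolymorphism : (k : ℕ) → Op k → Set
IsPolymorphism k f = (x y : Fin k → V) → ((i : Fin k) → E (x i) (y i)) → E (f x) (f y)

EssentiallyUnary : (k : ℕ) → Op k → Set
EssentiallyUnary k f = Σ (V → V) λ g → Σ (Fin k) λ i → (x : Fin k → V) → f x ≡ g (x i)

module Submission where

open import Data.Nat using (ℕ; suc)
open import Defs

open import Data.Nat using (zero; _<_; _≤_; z≤n; s≤s)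
open import Data.Nat.Properties using (<-cmp; <⇒≤; ≤⇒≯; ≤-reflexive; m<n⇒m<1+n; _<?_)
open import Data.Fin using (Fin; zero; suc; toℕ; fromℕ<; _↑ˡ_; _↑ʳ_; _≟_)
open import Data.Fin.Properties using (all?; toℕ<n; toℕ-fromℕ<; toℕ-injective)
open import Data.Vec.Functional using ([]; _∷_)
open import Data.Product using (Σ; ∃-syntax; _×_; _,_; proj₁; proj₂)
open import Data.Sum using (_⊎_; inj₁; inj₂)
open import Function using (id; const; _∘_)
open import Relation.Binary using (tri<; tri≈; tri>)
open import Relation.Binary.PropositionalEquality using (_≡_; _≢_; _≗_; refl; sym; trans; cong; subst; module ≡-Reasoning)
open import Relation.Nullary using (Dec; yes; no; ¬_; contradiction)
open import Relation.Nullary.Decidable using (True; toWitness)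
open import Relation.Unary using (Decidable)

-- The loops of H are 1 and 2, so f(1,…,1) and f(2,…,2) are loops joined by
-- an edge.  If they coincide, squeezing every tuple between them forces f to
-- be constant.  Otherwise f fixes 1 and 2; along the tuples 2…21…1 its value
-- switches from 1 to 2 when some coordinate j turns into a 2.  Identifying the
-- variables of f by their side of j and their value leaves a 7-ary
-- polymorphism whose values are forced one after another by the edges of H,
-- and they show f(x) = x_j.

triangle-rigid : ∀ {a b c d} → E a b → E b c → E c a → E c d → E d b → d ≡ a
triangle-rigid e01 e12 e20 e20 e01 = refl
triangle-rigid e11 e11 e11 e11 e11 = refl
triangle-rigid e12 e20 e01 e01 e12 = refl
triangle-rigid e22 e22 e22 e22 e22 = refl
triangle-rigid e20 e01 e12 e12 e20 = refl

rotate : V → V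
rotate zero = v1
rotate (suc zero) = v2
rotate (suc (suc zero)) = v0

E-rotate : ∀ a → E a (rotate a)
E-rotate zero = e01
E-rotate (suc zero) = e12
E-rotate (suc (suc zero)) = e20

E-rotate² : ∀ a → E (rotate (rotate a)) a
E-rotate² zero = e20
E-rotate² (suc zero) = e01
E-rotate² (suc (suc zero)) = e12

between-1-1 : ∀ {a b c} → E b a → E a c → b ≡ v1 → c ≡ v1 → a ≡ v1
between-1-1 e11 e11 refl refl = refl
between-1-1 e12 e20 refl ()
between-1-1 e12 e22 refl ()

between-2-2 : ∀ {a b c} → E b a → E a c → b ≡ v2 → c ≡ v2 → a ≡ v2
between-2-2 e22 e22 refl refl = refl
between-2-2 e20 e01 refl ()

between-1-2 : ∀ {a b c} → E b a → E a c → b ≡ v1 → c ≡ v2 → a ≡ v1 ⊎ a ≡ v2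
between-1-2 e11 e11 refl ()
between-1-2 e11 e12 refl refl = inj₁ refl
between-1-2 e12 e22 refl refl = inj₂ refl
between-1-2 e12 e20 refl ()

between-2-1 : ∀ {a b c} → E b a → E a c → b ≡ v2 → c ≡ v1 → a ≡ v0
between-2-1 e22 e22 refl ()
between-2-1 e22 e20 refl ()
between-2-1 e20 e01 refl refl = refl

common-out-1-2 : ∀ {a b c} → E b a → E c a → b ≡ v1 → c ≡ v2 → a ≡ v2
common-out-1-2 e11 e01 refl ()
common-out-1-2 e11 e11 refl ()
common-out-1-2 e12 e12 refl ()
common-out-1-2 e12 e22 refl refl = refl

common-in-1-2 : ∀ {a b c} → E a b → E a c → b ≡ v1 → c ≡ v2 → a ≡ v1
common-in-1-2 e01 e01 refl ()
common-in-1-2 e11 e11 refl ()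
common-in-1-2 e11 e12 refl refl = refl

out-0 : ∀ {a b} → E b a → b ≡ v0 → a ≡ v1
out-0 e01 refl = refl

in-0 : ∀ {a b} → E a b → b ≡ v0 → a ≡ v2
in-0 e20 refl = refl

up down : V → V
up zero = v1
up (suc zero) = v1
up (suc (suc zero)) = v2
down zero = v2
down (suc zero) = v1
down (suc (suc zero)) = v2

E-up : ∀ a → E a (up a)
E-up zero = e01
E-up (suc zero) = e11
E-up (suc (suc zero)) = e22

E-down : ∀ a → E (down a) a
E-down zero = e20
E-down (suc zero) = e11
E-down (suc (suc zero)) = e22

up-between-1-2 : ∀ a → E v1 (up a) × E (up a) v2
up-between-1-2 zero = e11 , e12
up-between-1-2 (suc zero) = e11 , e12
up-between-1-2 (suc (suc zero)) = e12 , e22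

down-between-1-2 : ∀ a → E v1 (down a) × E (down a) v2
down-between-1-2 zero = e12 , e22
down-between-1-2 (suc zero) = e11 , e12
down-between-1-2 (suc (suc zero)) = e12 , e22

data LoopEdge (a b : V) : Set where
  both-1 : a ≡ v1 → b ≡ v1 → LoopEdge a b
  1-to-2 : a ≡ v1 → b ≡ v2 → LoopEdge a b
  both-2 : a ≡ v2 → b ≡ v2 → LoopEdge a b

loop-edge : ∀ {a b} → E a a → E b b → E a b → LoopEdge a b
loop-edge e11 e11 e11 = both-1 refl refl
loop-edge e11 e22 e12 = 1-to-2 refl refl
loop-edge e22 e22 e22 = both-2 refl refl

infix 4 _E?_
_E?_ : (a b : V) → Dec (E a b)
zero E? zero = no λ ()
zero E? suc zero = yes e01
zero E? suc (suc zero) = no λ ()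
suc zero E? zero = no λ ()
suc zero E? suc zero = yes e11
suc zero E? suc (suc zero) = yes e12
suc (suc zero) E? zero = yes e20
suc (suc zero) E? suc zero = no λ ()
suc (suc zero) E? suc (suc zero) = yes e22

crossing : ∀ {p} {P : ℕ → Set p} → Decidable P →
           ∀ n → P 0 → ¬ P n → ∃[ j ] j < n × P j × ¬ P (suc j)
crossing P? zero p₀ ¬pₙ = contradiction p₀ ¬pₙ
crossing P? (suc n) p₀ ¬pₙ with P? 1
... | no ¬p₁ = 0 , s≤s z≤n , p₀ , ¬p₁
... | yes p₁ with crossing (P? ∘ suc) n p₁ ¬pₙ
...   | j , j<n , pⱼ , ¬pⱼ₊₁ = suc j , s≤s j<n , pⱼ , ¬pⱼ₊₁

threshold : ∀ {n} → ℕ → Fin n → V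
threshold m c with toℕ c <? m
... | yes _ = v2
... | no _ = v1

threshold-below : ∀ {n m} {c : Fin n} → toℕ c < m → threshold m c ≡ v2
threshold-below {m = m} {c} c<m with toℕ c <? m
... | yes _ = refl
... | no c≮m = contradiction c<m c≮m

threshold-above : ∀ {n m} {c : Fin n} → m ≤ toℕ c → threshold m c ≡ v1
threshold-above {m = m} {c} m≤c with toℕ c <? m
... | yes c<m = contradiction c<m (≤⇒≯ m≤c)
... | no _ = refl

threshold-between-1-2 : ∀ {n} m (c : Fin n) → E v1 (threshold m c) × E (threshold m c) v2
threshold-between-1-2 m c with toℕ c <? m
... | yes _ = e12 , e22
... | no _ = e11 , e12

block : (V → V) → V → (V → V) → Fin 7 → V
block α v β = α v0 ∷ α v1 ∷ α v2 ∷ v ∷ β v0 ∷ β v1 ∷ β v2 ∷ []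

block-lower : ∀ α v β w → block α v β (w ↑ˡ 4) ≡ α w
block-lower α v β zero = refl
block-lower α v β (suc zero) = refl
block-lower α v β (suc (suc zero)) = refl

block-upper : ∀ α v β w → block α v β (4 ↑ʳ w) ≡ β w
block-upper α v β zero = refl
block-upper α v β (suc zero) = refl
block-upper α v β (suc (suc zero)) = refl

module _ (g : Op 7) (g-pol : IsPolymorphism 7 g) where

  private
    edge : (x y : Fin 7 → V) → {True (all? λ i → x i E? y i)} → E (g x) (g y)
    edge x y {x↦y} = g-pol x y (toWitness x↦y)

  pivot-projection : g (block (const v1) v1 (const v1)) ≡ v1 →
                     g (block (const v2) v1 (const v1)) ≡ v1 →
                     g (block (const v2) v2 (const v1)) ≡ v2 →
                     ∀ v → g (block id v id) ≡ v
  pivot-projection g₁₁₁ g₂₁₁ g₂₂₁ = λ where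
      zero → between-2-1 (edge u₄ (block id v0 id)) (edge (block id v0 id) u₃) g-u₄ g-u₃
      (suc zero) → out-0 (edge u₇ (block id v1 id)) g-u₇
      (suc (suc zero)) → in-0 (edge (block id v2 id) u₂) g-u₂
    where
    b₁₁₁ b₂₁₁ b₂₂₁ : Fin 7 → V
    b₁₁₁ = block (const v1) v1 (const v1)
    b₂₁₁ = block (const v2) v1 (const v1)
    b₂₂₁ = block (const v2) v2 (const v1)

    u₁ u₂ u₃ u₄ u₅ u₆ u₇ : Fin 7 → V
    u₁ = v0 ∷ v0 ∷ v2 ∷ v2 ∷ v1 ∷ v1 ∷ v2 ∷ []
    u₂ = v1 ∷ v1 ∷ v0 ∷ v0 ∷ v1 ∷ v1 ∷ v0 ∷ []
    u₃ = v1 ∷ v1 ∷ v2 ∷ v1 ∷ v1 ∷ v1 ∷ v0 ∷ []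
    u₄ = v2 ∷ v0 ∷ v2 ∷ v2 ∷ v2 ∷ v1 ∷ v1 ∷ []
    u₅ = v2 ∷ v1 ∷ v1 ∷ v1 ∷ v0 ∷ v1 ∷ v1 ∷ []
    u₆ = v2 ∷ v2 ∷ v0 ∷ v2 ∷ v1 ∷ v2 ∷ v1 ∷ []
    u₇ = v2 ∷ v0 ∷ v1 ∷ v0 ∷ v2 ∷ v0 ∷ v1 ∷ []

    g-u₁ : g u₁ ≡ v2
    g-u₁ = common-out-1-2 (edge b₂₁₁ u₁) (edge b₂₂₁ u₁) g₂₁₁ g₂₂₁
    g-u₂ : g u₂ ≡ v0
    g-u₂ = between-2-1 (edge u₁ u₂) (edge u₂ b₁₁₁) g-u₁ g₁₁₁
    g-u₃ : g u₃ ≡ v1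
    g-u₃ = common-in-1-2 (edge u₃ b₂₁₁) (edge u₃ b₂₂₁) g₂₁₁ g₂₂₁
    g-u₄ : g u₄ ≡ v2
    g-u₄ = common-out-1-2 (edge b₂₁₁ u₄) (edge b₂₂₁ u₄) g₂₁₁ g₂₂₁
    g-u₅ : g u₅ ≡ v1
    g-u₅ = common-in-1-2 (edge u₅ b₂₁₁) (edge u₅ b₂₂₁) g₂₁₁ g₂₂₁
    g-u₆ : g u₆ ≡ v2
    g-u₆ = common-out-1-2 (edge b₂₁₁ u₆) (edge b₂₂₁ u₆) g₂₁₁ g₂₂₁
    g-u₇ : g u₇ ≡ v0
    g-u₇ = between-2-1 (edge u₆ u₇) (edge u₇ u₅) g-u₆ g-u₅

position : ∀ {n} → ℕ → (Fin n → V) → Fin n → Fin 7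
position j x c with <-cmp (toℕ c) j
... | tri< _ _ _ = x c ↑ˡ 4
... | tri≈ _ _ _ = suc (suc (suc zero))
... | tri> _ _ _ = 4 ↑ʳ x c

block-position : ∀ {n} j (x y : Fin n → V) α v β →
                 (∀ c → toℕ c < j → y c ≡ α (x c)) →
                 (∀ c → toℕ c ≡ j → y c ≡ v) →
                 (∀ c → j < toℕ c → y c ≡ β (x c)) →
                 y ≗ block α v β ∘ position j x
block-position j x y α v β below at above c with <-cmp (toℕ c) j
... | tri< c<j _ _ = trans (below c c<j) (sym (block-lower α v β (x c)))
... | tri≈ _ c≡j _ = at c c≡j
... | tri> _ _ j<c = trans (above c j<c) (sym (block-upper α v β (x c)))

module _ {n} {f : Op n} (f-pol : IsPolymorphism n f) where

  -- Agda has no function extensionality; here it comes from the rigidity of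
  -- the triangle x → rotate ∘ x → rotate² ∘ x → x of tuples.
  pol-cong : ∀ {x y} → x ≗ y → f x ≡ f y
  pol-cong {x} {y} x≗y = sym (triangle-rigid
    (f-pol x x⁺ (E-rotate ∘ x))
    (f-pol x⁺ x⁺⁺ (E-rotate ∘ x⁺))
    (f-pol x⁺⁺ x (E-rotate² ∘ x))
    (f-pol x⁺⁺ y λ c → subst (E (x⁺⁺ c)) (x≗y c) (E-rotate² (x c)))
    (f-pol y x⁺ λ c → subst (λ z → E z (x⁺ c)) (x≗y c) (E-rotate (x c))))
    where
    x⁺ x⁺⁺ : Fin n → V
    x⁺ = rotate ∘ x
    x⁺⁺ = rotate ∘ x⁺

  constant : ∀ {w} → (∀ {a b c} → E b a → E a c → b ≡ w → c ≡ w → a ≡ w) →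
             f (const v1) ≡ w → f (const v2) ≡ w → ∀ x → f x ≡ w
  constant {w} between f₁ f₂ x =
    between (f-pol (down ∘ x) x (E-down ∘ x)) (f-pol x (up ∘ x) (E-up ∘ x))
            (squeezed (down ∘ x) (down-between-1-2 ∘ x))
            (squeezed (up ∘ x) (up-between-1-2 ∘ x))
    where
    squeezed : ∀ y → (∀ c → E v1 (y c) × E (y c) v2) → f y ≡ w
    squeezed y 1↦y↦2 = between (f-pol (const v1) y (proj₁ ∘ 1↦y↦2))
                               (f-pol y (const v2) (proj₂ ∘ 1↦y↦2)) f₁ f₂

  projection-at-crossing : ∀ {j} (j<n : j < n) → f (const v1) ≡ v1 →
                           f (threshold j) ≡ v1 → f (threshold (suc j)) ≡ v2 →
                           ∀ x → f x ≡ x (fromℕ< j<n)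
  projection-at-crossing {j} j<n f₁ fⱼ fⱼ₊₁ x = begin
      f x                              ≡⟨ pol-cong (block-position j x x id (x jₙ) id
                                                      (λ _ _ → refl) at-j (λ _ _ → refl)) ⟩
      g (block id (x jₙ) id)           ≡⟨ pivot-projection g g-pol g₁₁₁ g₂₁₁ g₂₂₁ (x jₙ) ⟩
      x jₙ                             ∎
    where
    open ≡-Reasoning
    jₙ : Fin n
    jₙ = fromℕ< j<n

    at-j : ∀ c → toℕ c ≡ j → x c ≡ x jₙ
    at-j c c≡j = cong x (toℕ-injective (trans c≡j (sym (toℕ-fromℕ< j<n))))

    g : Op 7
    g y = f (y ∘ position j x)

    g-pol : IsPolymorphism 7 g
    g-pol y z y↦z = f-pol _ _ (y↦z ∘ position j x)

    g₁₁₁ : g (block (const v1) v1 (const v1)) ≡ v1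
    g₁₁₁ = trans (sym (pol-cong (block-position j x (const v1) (const v1) v1 (const v1)
                                   (λ _ _ → refl) (λ _ _ → refl) (λ _ _ → refl)))) f₁
    g₂₁₁ : g (block (const v2) v1 (const v1)) ≡ v1
    g₂₁₁ = trans (sym (pol-cong (block-position j x (threshold j) (const v2) v1 (const v1)
                                   (λ _ c<j → threshold-below c<j)
                                   (λ _ c≡j → threshold-above (≤-reflexive (sym c≡j)))
                                   (λ _ j<c → threshold-above (<⇒≤ j<c))))) fⱼ
    g₂₂₁ : g (block (const v2) v2 (const v1)) ≡ v2
    g₂₂₁ = trans (sym (pol-cong (block-position j x (threshold (suc j)) (const v2) v2 (const v1)
                                   (λ _ c<j → threshold-below (m<n⇒m<1+n c<j))
                                   (λ _ c≡j → threshold-below (s≤s (≤-reflexive c≡j)))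
                                   (λ _ j<c → threshold-above j<c)))) fⱼ₊₁

  projection : f (const v1) ≡ v1 → f (const v2) ≡ v2 → Σ (Fin n) λ i → ∀ x → f x ≡ x i
  projection f₁ f₂ =
    let j , j<n , fⱼ , fⱼ₊₁≢1 = crossing (λ m → f (threshold m) ≟ v1) n f-threshold-0 f-threshold-n
    in fromℕ< j<n , projection-at-crossing j<n f₁ fⱼ (f-threshold-≢1 (suc j) fⱼ₊₁≢1)
    where
    f-threshold-0 : f (threshold 0) ≡ v1
    f-threshold-0 = trans (pol-cong λ c → threshold-above {c = c} z≤n) f₁

    f-threshold-n : f (threshold n) ≢ v1
    f-threshold-n fₙ≡1 =
      contradiction (trans (sym fₙ≡1) (trans (pol-cong λ c → threshold-below (toℕ<n c)) f₂)) λ ()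

    f-threshold-≢1 : ∀ m → f (threshold m) ≢ v1 → f (threshold m) ≡ v2
    f-threshold-≢1 m ≢1 with between-1-2 (f-pol (const v1) _ (proj₁ ∘ threshold-between-1-2 m))
                                         (f-pol _ (const v2) (proj₂ ∘ threshold-between-1-2 m)) f₁ f₂
    ... | inj₁ ≡1 = contradiction ≡1 ≢1
    ... | inj₂ ≡2 = ≡2

lemma28 : (k : ℕ) → (f : Op (suc k)) → IsPolymorphism (suc k) f → EssentiallyUnary (suc k) f
lemma28 k f f-pol with loop-edge (f-pol (const v1) (const v1) (λ _ → e11))
                                 (f-pol (const v2) (const v2) (λ _ → e22))
                                 (f-pol (const v1) (const v2) (λ _ → e12))
... | both-1 f₁ f₂ = const v1 , zero , constant f-pol between-1-1 f₁ f₂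
... | both-2 f₁ f₂ = const v2 , zero , constant f-pol between-2-2 f₁ f₂
... | 1-to-2 f₁ f₂ with projection f-pol f₁ f₂
...   | i , f≡xᵢ = id , i , f≡xᵢ
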